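{- Let $d\ge1$, $k_1,\dots,k_d\ge1$, and let $f$ be the function defined in the context. Let $p$ be a polynomial with integer coefficients of degree at most $d$ in the variables $x^i_j,y^i_j$ such that $f(x,y)=\mathrm{sgn}(p(x,y))$ for all inputs. Let $p'(u,v)=2^d\,p\big(\tfrac{u+v}{2},\tfrac{u-v}{2}\big)$, i.e. $p'$ is obtained by substituting $x^i_j=(u^i_j+v^i_j)/2$, $y^i_j=(u^i_j-v^i_j)/2$ and multiplying by $2^d$, so that $f(x,y)=\mathrm{sgn}(p'(x-y,x+y))$. Let $q$ be the polynomial obtained from $p'$ by replacing by $0$ the coefficient of every monomial that contains no variable from at least one of the groups $u^1=(u^1_1,\dots,u^1_{k_1}),\dots,u^d=(u^d_1,\dots,u^d_{k_d})$. Then $q$ also sign-represents $f$: $f(x,y)=\mathrm{sgn}(q(x-y,x+y))$ for all $x,y$.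
   Context: $\mathrm{sgn}(t)=1$ if $t\ge 0$ and $0$ otherwise. The function $f$: the input is $(x^1,\dots,x^d,y^1,\dots,y^d)$ with $x^i,y^i\in\{0,1\}^{k_i}$. For $[k]=\{1,\dots,k\}$ let $<_1$ be the order $1,2,\dots,k$ and $<_0$ the order $k,\dots,1$; $\mathrm{num}_1(j)=j$, $\mathrm{num}_0(j)=k-j+1$. Let $K=[k_1]\times\dots\times[k_d]$; for $\alpha\in K$ let $i_1(\alpha)=1$ and $i_{l+1}(\alpha)=\mathrm{num}_{i_l(\alpha)}(\alpha_l)\bmod 2$. For $\alpha\ne\beta$ with first differing index $l$, $\alpha<\beta$ iff $\alpha_l$ precedes $\beta_l$ in $<_{i_l(\alpha)}$ on $[k_l]$. For $\alpha$ the largest element of $K$ with $\prod_{i}(x^i_{\alpha_i}-y^i_{\alpha_i})\neq0$, $f(x,y)=\mathrm{sgn}\prod_i(x^i_{\alpha_i}-y^i_{\alpha_i})$; if none exists, $f(x,y)=1$. -}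

module Defs where

open import Data.Nat as ℕ using (ℕ; zero; suc; _∸_; _≤_; _%_; _<ᵇ_; _≡ᵇ_)
open import Data.Integer as ℤ using (ℤ; +_; _*_; _+_; _-_; -_; _≤ᵇ_; 0ℤ; 1ℤ)
open import Data.Fin as Fin using (Fin; toℕ; zero; suc)
open import Data.Fin.Properties using () renaming (_≟_ to _≟F_)
open import Data.Bool using (Bool; true; false; if_then_else_; _∧_; not)
open import Data.List using (List; []; _∷_; _++_; map; concatMap; filter; foldr; length; allFin)
open import Data.Bool.ListAction using (any; all)
open import Data.Maybe using (Maybe; just; nothing)
open import Data.Product using (Σ; _×_; _,_; proj₁; proj₂)
open import Relation.Nullary.Decidable using (⌊_⌋; does)
open import Relation.Binary.PropositionalEquality using (_≡_)

-- Index set K = [k_1] × ... × [k_d]  (0-based: coordinate i ranges over Fin (k i),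
-- the element j : Fin (k i) stands for j+1 ∈ [k_i]).

K : (d : ℕ) → (Fin d → ℕ) → Set
K d k = (i : Fin d) → Fin (k i)

allK : (d : ℕ) → (k : Fin d → ℕ) → List (K d k)
allK zero    k = (λ ()) ∷ []
allK (suc d) k =
  concatMap (λ j → map (λ α → cons j α) (allK d (λ i → k (suc i)))) (allFin (k zero))
  where
  cons : Fin (k zero) → K d (λ i → k (suc i)) → K (suc d) k
  cons j α zero    = j
  cons j α (suc i) = α i

-- num_b(j) for j ∈ [kk] (given 0-based as j : Fin kk):
-- num_1(j) = j, num_0(j) = kk - j + 1.
num : (kk : ℕ) → Bool → Fin kk → ℕ
num kk true  j = suc (toℕ j)
num kk false j = kk ∸ toℕ j

nextBit : (kk : ℕ) → Bool → Fin kk → Bool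
nextBit kk b j = (num kk b j % 2) ≡ᵇ 1

precedes : Bool → ℕ → ℕ → Bool
precedes true  j j' = j <ᵇ j'
precedes false j j' = j' <ᵇ j

-- ltFrom b α β : α < β, where b = i_l(α) is the orientation bit at the current
-- (first remaining) coordinate.  Initially i_1 = 1.
ltFrom : (d : ℕ) → (k : Fin d → ℕ) → Bool → K d k → K d k → Bool
ltFrom zero    k b α β = false
ltFrom (suc d) k b α β =
  if toℕ (α zero) ≡ᵇ toℕ (β zero)
  then ltFrom d (λ i → k (suc i)) (nextBit (k zero) b (α zero))
              (λ i → α (suc i)) (λ i → β (suc i))
  else precedes b (toℕ (α zero)) (toℕ (β zero))

_<K_ : {d : ℕ} {k : Fin d → ℕ} → K d k → K d k → Bool
_<K_ {d} {k} α β = ltFrom d k true α β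

maxK : {d : ℕ} {k : Fin d → ℕ} → List (K d k) → Maybe (K d k)
maxK [] = nothing
maxK (α ∷ αs) with maxK αs
... | nothing = just α
... | just β  = just (if α <K β then β else α)

Input : (d : ℕ) → (Fin d → ℕ) → Set
Input d k = (i : Fin d) → Fin (k i) → Bool

bit : Bool → ℤ
bit true  = 1ℤ
bit false = 0ℤ

prodFin : (d : ℕ) → (Fin d → ℤ) → ℤ
prodFin zero    g = 1ℤ
prodFin (suc d) g = g zero * prodFin d (λ i → g (suc i))

diffProd : (d : ℕ) (k : Fin d → ℕ) → Input d k → Input d k → K d k → ℤ
diffProd d k x y α = prodFin d (λ i → bit (x i (α i)) - bit (y i (α i)))

sgn : ℤ → ℕ
sgn t = if 0ℤ ≤ᵇ t then 1 else 0

isNonzero : ℤ → Bool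
isNonzero (+ zero) = false
isNonzero _        = true

f : (d : ℕ) (k : Fin d → ℕ) → Input d k → Input d k → ℕ
f d k x y with maxK (filter (λ α → Data.Bool._≟_ (isNonzero (diffProd d k x y α)) true)
                             (allK d k))
... | nothing = 1
... | just α  = sgn (diffProd d k x y α)

-- Polynomials with integer coefficients, as formal sums of terms c·m where
-- a monomial m is a list (multiset) of variables.

-- A variable: side ∈ Bool (for p: true = x, false = y; for p': true = u, false = v),
-- group i ∈ Fin d, index j ∈ Fin (k i).  I.e. x^i_j / y^i_j, resp. u^i_j / v^i_j.
record Var (d : ℕ) (k : Fin d → ℕ) : Set where
  constructor var
  field
    side : Bool
    grp  : Fin d
    idx  : Fin (k grp)
open Var public

Poly : (d : ℕ) → (Fin d → ℕ) → Set
Poly d k = List (ℤ × List (Var d k))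

evalMono : {d : ℕ} {k : Fin d → ℕ} → (Var d k → ℤ) → List (Var d k) → ℤ
evalMono ρ m = foldr (λ w acc → ρ w * acc) 1ℤ m

eval : {d : ℕ} {k : Fin d → ℕ} → (Var d k → ℤ) → Poly d k → ℤ
eval ρ p = foldr (λ t acc → proj₁ t * evalMono ρ (proj₂ t) + acc) 0ℤ p

DegreeAtMost : {d : ℕ} {k : Fin d → ℕ} → ℕ → Poly d k → Set
DegreeAtMost n p = Data.List.Relation.Unary.All.All (λ t → length (proj₂ t) ≤ n) p
  where import Data.List.Relation.Unary.All

mulP : {d : ℕ} {k : Fin d → ℕ} → Poly d k → Poly d k → Poly d k
mulP p q = concatMap (λ s → map (λ t → (proj₁ s * proj₁ t , proj₂ s ++ proj₂ t)) q) p

oneP : {d : ℕ} {k : Fin d → ℕ} → Poly d k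
oneP = (1ℤ , []) ∷ []

scaleP : {d : ℕ} {k : Fin d → ℕ} → ℤ → Poly d k → Poly d k
scaleP c = map (λ t → (c * proj₁ t , proj₂ t))

-- substitution of 2·x^i_j = u^i_j + v^i_j,  2·y^i_j = v^i_j - u^i_j
-- (so that u = x - y, v = x + y).  A variable is sent to twice its substituted value.
twiceSubst : {d : ℕ} {k : Fin d → ℕ} → Var d k → Poly d k
twiceSubst (var true  i j) = (1ℤ , var true i j ∷ []) ∷ (1ℤ , var false i j ∷ []) ∷ []
twiceSubst (var false i j) = (- 1ℤ , var true i j ∷ []) ∷ (1ℤ , var false i j ∷ []) ∷ []

-- p'(u,v) = 2^d p((u+v)/2, (v-u)/2):  a term c·m with |m| ≤ d becomes
-- c · 2^(d-|m|) · ∏_{w ∈ m} (2 w)[substituted].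
primeP : (d : ℕ) (k : Fin d → ℕ) → Poly d k → Poly d k
primeP d k p =
  concatMap (λ t → scaleP (proj₁ t * (+ (2 ℕ.^ (d ∸ length (proj₂ t)))))
                          (foldr (λ w acc → mulP (twiceSubst w) acc) oneP (proj₂ t)))
            p

hasU : {d : ℕ} {k : Fin d → ℕ} → Fin d → List (Var d k) → Bool
hasU i m = any (λ w → side w ∧ ⌊ grp w ≟F i ⌋) m

qP : (d : ℕ) (k : Fin d → ℕ) → Poly d k → Poly d k
qP d k p = filter (λ t → Data.Bool._≟_ (all (λ i → hasU i (proj₂ t)) (allFin d)) true)
                  (primeP d k p)

atXY : {d : ℕ} {k : Fin d → ℕ} → Input d k → Input d k → Var d k → ℤ
atXY x y (var true  i j) = bit (x i j)
atXY x y (var false i j) = bit (y i j)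

atUV : {d : ℕ} {k : Fin d → ℕ} → Input d k → Input d k → Var d k → ℤ
atUV x y (var true  i j) = bit (x i j) - bit (y i j)
atUV x y (var false i j) = bit (x i j) + bit (y i j)

module Submission where

-- At (u, v) = (x - y, x + y) we have p′ = 2^d · p, so p′ sign-represents f.
-- Call an input decisive if some product ∏_i (x^i_{α_i} - y^i_{α_i}) is nonzero.
-- Exchanging group i of x and y negates the variables u^i and negates every such
-- product, so on decisive inputs it flips f; hence if g sign-represents f on decisive
-- inputs, so does g - g ∘ swap_i.  Doing this for every group multiplies each monomial
-- m of p′ by ∏_i (1 - (-1)^(number of u^i in m)).  As deg m ≤ d, this weight is 2^d if
-- m meets every group (then exactly once each) and 0 otherwise: the result is 2^d · q.
-- If some group of x equals that of y, then f = 1 and q vanishes, because each of its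
-- monomials contains a variable u^i = 0.

open import Defs
open import Data.Nat as ℕ using (ℕ; zero; suc; _∸_; _≤_; z≤n; s≤s)
import Data.Nat.Properties as ℕP
open import Data.Integer as ℤ using (ℤ; +_; -[1+_]; _*_; _+_; _-_; -_; _^_; 0ℤ; 1ℤ)
import Data.Integer.Properties as ℤP
open import Data.Integer.Tactic.RingSolver using (solve-∀)
open import Data.Fin using (Fin; zero; suc)
open import Data.Fin.Properties using (suc-injective; all?; any?; ¬∀⟶∃¬) renaming (_≟_ to _≟F_)
open import Data.Bool as Bool using (Bool; true; false; T; if_then_else_; _∧_)
open import Data.Bool.ListAction using (all)
open import Data.Bool.Properties using (T-≡)
open import Function.Bundles using (Equivalence)
open import Data.List using (List; []; _∷_; _++_; map; foldr; length; filter; allFin)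
open import Data.List.Properties using (length-++; length-tabulate; filter-≐)
open import Data.List.Relation.Unary.All as All using (All; []; _∷_)
open import Data.List.Relation.Unary.All.Properties using (concat⁺; map⁺; all⁺)
open import Data.List.Membership.Propositional using (_∈_; lose)
open import Data.List.Membership.Propositional.Properties
  using (∈-allFin; ∈-map⁺; ∈-concatMap⁺; ∈-filter⁺; ∈-filter⁻)
open import Data.List.Relation.Unary.Any as Any using (Any; here; there)
open import Data.List.Relation.Unary.Any.Properties using (any⁻)
open import Data.Maybe using (just; nothing)
open import Data.Product using (Σ; _×_; _,_; proj₁; proj₂)
open import Data.Empty using (⊥-elim)
open import Data.Sum using (_⊎_; inj₁; inj₂)
open import Function using (_∘_; id)
open import Relation.Nullary using (¬?)
open import Relation.Nullary.Decidable using (⌊_⌋; yes; no; decidable-stable)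
open import Relation.Binary.PropositionalEquality
open import Algebra.Properties.CommutativeMonoid.Sum ℕP.+-0-commutativeMonoid
  using (sum; ∑-distrib-+; sum-replicate-zero; sum-cong-≗)

sgn-*-pos : ∀ {n} → 0 ℕ.< n → ∀ t → sgn (+ n * t) ≡ sgn t
sgn-*-pos {suc n} _ (+ m) rewrite ℤP.+◃n≡+n (m ℕ.+ n ℕ.* m) = refl
sgn-*-pos {suc n} _ -[1+ m ] = refl

sgn-neg : ∀ t → t ≢ 0ℤ → sgn (- t) ≢ sgn t
sgn-neg (+ zero) t≢0 = ⊥-elim (t≢0 refl)
sgn-neg (+ suc n) _ ()
sgn-neg -[1+ n ] _ ()

sgn-sub : ∀ a b → sgn a ≢ sgn b → sgn (a - b) ≡ sgn a
sgn-sub (+ m) (+ r) ne = ⊥-elim (ne refl)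
sgn-sub (+ m) -[1+ r ] _ = refl
sgn-sub -[1+ m ] (+ zero) _ = refl
sgn-sub -[1+ m ] (+ suc r) _ = refl
sgn-sub -[1+ m ] -[1+ r ] ne = ⊥-elim (ne refl)

sum-≥-length : ∀ {n} (c : Fin n → ℕ) → (∀ i → 1 ≤ c i) → n ≤ sum c
sum-≥-length {zero} c pos = z≤n
sum-≥-length {suc n} c pos = ℕP.+-mono-≤ (pos zero) (sum-≥-length (λ i → c (suc i)) (λ i → pos (suc i)))

sum-tight : ∀ {n} (c : Fin n → ℕ) → (∀ i → 1 ≤ c i) → sum c ≤ n → ∀ i → c i ≡ 1
sum-tight {suc n} c pos le zero = ℕP.≤-antisym c₀≤1 (pos zero)
  where
  c₀≤1 : c zero ≤ 1
  c₀≤1 = ℕP.+-cancelʳ-≤ n (c zero) 1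
           (ℕP.≤-trans (ℕP.+-monoʳ-≤ (c zero) (sum-≥-length _ (λ i → pos (suc i)))) le)
sum-tight {suc n} c pos le (suc i) = sum-tight (λ i → c (suc i)) (λ i → pos (suc i)) rest≤n i
  where
  rest≤n : sum (λ i → c (suc i)) ≤ n
  rest≤n = ℕ.s≤s⁻¹ (ℕP.≤-trans (ℕP.+-monoˡ-≤ _ (pos zero)) le)

sum-indicator : ∀ {n} (g : Fin n) → sum (λ i → if ⌊ g ≟F i ⌋ then 1 else 0) ≡ 1
sum-indicator {suc n} zero = cong suc (sum-replicate-zero n)
sum-indicator {suc n} (suc g) =
  trans (sum-cong-≗ (λ i → cong (if_then 1 else 0) (⌊suc≟suc⌋ i))) (sum-indicator g)
  where
  ⌊suc≟suc⌋ : ∀ i → ⌊ suc g ≟F suc i ⌋ ≡ ⌊ g ≟F i ⌋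
  ⌊suc≟suc⌋ i with g ≟F i
  ... | yes _ = refl
  ... | no _ = refl

prodFin-cong : ∀ n {g g′ : Fin n → ℤ} → (∀ i → g i ≡ g′ i) → prodFin n g ≡ prodFin n g′
prodFin-cong zero eq = refl
prodFin-cong (suc n) eq = cong₂ _*_ (eq zero) (prodFin-cong n (λ i → eq (suc i)))

prodFin-zero : ∀ n (g : Fin n → ℤ) i → g i ≡ 0ℤ → prodFin n g ≡ 0ℤ
prodFin-zero (suc n) g zero gᵢ≡0 rewrite gᵢ≡0 = refl
prodFin-zero (suc n) g (suc i) gᵢ≡0
  rewrite prodFin-zero n (λ i → g (suc i)) i gᵢ≡0 = ℤP.*-zeroʳ (g zero)

prodFin-nonzero : ∀ n (g : Fin n → ℤ) → (∀ i → g i ≢ 0ℤ) → prodFin n g ≢ 0ℤ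
prodFin-nonzero zero g nz ()
prodFin-nonzero (suc n) g nz eq with ℤP.i*j≡0⇒i≡0∨j≡0 (g zero) eq
... | inj₁ g₀≡0 = nz zero g₀≡0
... | inj₂ rest≡0 = prodFin-nonzero n (λ i → g (suc i)) (λ i → nz (suc i)) rest≡0

prodFin-negate : ∀ n (g g′ : Fin n → ℤ) i → (∀ i′ → i′ ≢ i → g′ i′ ≡ g i′) → g′ i ≡ - g i →
  prodFin n g′ ≡ - prodFin n g
prodFin-negate (suc n) g g′ zero same neg =
  trans (cong₂ _*_ neg (prodFin-cong n (λ i → same (suc i) (λ ()))))
        (sym (ℤP.neg-distribˡ-* (g zero) _))
prodFin-negate (suc n) g g′ (suc i) same neg =
  trans (cong₂ _*_ (same zero (λ ()))
          (prodFin-negate n (λ i → g (suc i)) (λ i → g′ (suc i)) i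
             (λ i′ i′≢i → same (suc i′) (i′≢i ∘ suc-injective)) neg))
        (sym (ℤP.neg-distribʳ-* (g zero) _))

module _ {d : ℕ} {k : Fin d → ℕ} where

  Assignment : Set
  Assignment = Var d k → ℤ

  evalMono-++ : ∀ (ρ : Assignment) a b → evalMono ρ (a ++ b) ≡ evalMono ρ a * evalMono ρ b
  evalMono-++ ρ [] b = sym (ℤP.*-identityˡ _)
  evalMono-++ ρ (w ∷ a) b rewrite evalMono-++ ρ a b = sym (ℤP.*-assoc (ρ w) _ _)

  eval-++ : ∀ (ρ : Assignment) (A B : Poly d k) → eval ρ (A ++ B) ≡ eval ρ A + eval ρ B
  eval-++ ρ [] B = sym (ℤP.+-identityˡ _)
  eval-++ ρ ((c , m) ∷ A) B rewrite eval-++ ρ A B = sym (ℤP.+-assoc (c * evalMono ρ m) _ _)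

  termTimes : ℤ × List (Var d k) → Poly d k → Poly d k
  termTimes s B = map (λ t → (proj₁ s * proj₁ t , proj₂ s ++ proj₂ t)) B

  eval-termTimes : ∀ (ρ : Assignment) a ma B →
    eval ρ (termTimes (a , ma) B) ≡ a * evalMono ρ ma * eval ρ B
  eval-termTimes ρ a ma [] = sym (ℤP.*-zeroʳ (a * evalMono ρ ma))
  eval-termTimes ρ a ma ((c , m) ∷ B)
    rewrite eval-termTimes ρ a ma B | evalMono-++ ρ ma m =
    distribute a c (evalMono ρ ma) (evalMono ρ m) (eval ρ B)
    where
    distribute : ∀ a c x y z → a * c * (x * y) + a * x * z ≡ a * x * (c * y + z)
    distribute = solve-∀

  eval-mulP : ∀ (ρ : Assignment) (A B : Poly d k) → eval ρ (mulP A B) ≡ eval ρ A * eval ρ B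
  eval-mulP ρ [] B = refl
  eval-mulP ρ ((a , ma) ∷ A) B = begin
    eval ρ (termTimes (a , ma) B ++ mulP A B)
      ≡⟨ eval-++ ρ (termTimes (a , ma) B) (mulP A B) ⟩
    eval ρ (termTimes (a , ma) B) + eval ρ (mulP A B)
      ≡⟨ cong₂ _+_ (eval-termTimes ρ a ma B) (eval-mulP ρ A B) ⟩
    a * evalMono ρ ma * eval ρ B + eval ρ A * eval ρ B
      ≡⟨ sym (ℤP.*-distribʳ-+ (eval ρ B) (a * evalMono ρ ma) (eval ρ A)) ⟩
    (a * evalMono ρ ma + eval ρ A) * eval ρ B ∎
    where open ≡-Reasoning

  eval-scaleP : ∀ (ρ : Assignment) c (A : Poly d k) → eval ρ (scaleP c A) ≡ c * eval ρ A
  eval-scaleP ρ c [] = sym (ℤP.*-zeroʳ c)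
  eval-scaleP ρ c ((a , m) ∷ A) rewrite eval-scaleP ρ c A =
    distribute c a (evalMono ρ m) (eval ρ A)
    where
    distribute : ∀ c a e z → c * a * e + c * z ≡ c * (a * e + z)
    distribute = solve-∀

  evalMono-cong : ∀ {ρ σ : Assignment} → (∀ w → ρ w ≡ σ w) → ∀ m → evalMono ρ m ≡ evalMono σ m
  evalMono-cong eq [] = refl
  evalMono-cong eq (w ∷ m) = cong₂ _*_ (eq w) (evalMono-cong eq m)

  eval-cong : ∀ {ρ σ : Assignment} → (∀ w → ρ w ≡ σ w) → ∀ P → eval ρ P ≡ eval σ P
  eval-cong eq [] = refl
  eval-cong eq ((c , m) ∷ P) = cong₂ _+_ (cong (c *_) (evalMono-cong eq m)) (eval-cong eq P)

  evalMono-scale : ∀ (ρ : Assignment) c m →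
    evalMono (λ w → + c * ρ w) m ≡ + (c ℕ.^ length m) * evalMono ρ m
  evalMono-scale ρ c [] = refl
  evalMono-scale ρ c (w ∷ m) = begin
    + c * ρ w * evalMono (λ w → + c * ρ w) m
      ≡⟨ cong (+ c * ρ w *_) (evalMono-scale ρ c m) ⟩
    + c * ρ w * (+ (c ℕ.^ length m) * evalMono ρ m)
      ≡⟨ regroup (+ c) (ρ w) (+ (c ℕ.^ length m)) (evalMono ρ m) ⟩
    + c * + (c ℕ.^ length m) * (ρ w * evalMono ρ m)
      ≡⟨ cong (_* (ρ w * evalMono ρ m)) (sym (ℤP.pos-* c (c ℕ.^ length m))) ⟩
    + (c ℕ.^ length (w ∷ m)) * evalMono ρ (w ∷ m) ∎
    where
    open ≡-Reasoning
    regroup : ∀ a r b e → a * r * (b * e) ≡ a * b * (r * e)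
    regroup = solve-∀

  substMono : (Var d k → Poly d k) → List (Var d k) → Poly d k
  substMono s m = foldr (λ w acc → mulP (s w) acc) oneP m

  eval-substMono : ∀ (σ : Assignment) s m → eval σ (substMono s m) ≡ evalMono (λ w → eval σ (s w)) m
  eval-substMono σ s [] = refl
  eval-substMono σ s (w ∷ m) =
    trans (eval-mulP σ (s w) (substMono s m)) (cong (eval σ (s w) *_) (eval-substMono σ s m))

  mulP-degree : ∀ {a b : ℕ} (A B : Poly d k) → DegreeAtMost a A → DegreeAtMost b B →
    DegreeAtMost (a ℕ.+ b) (mulP A B)
  mulP-degree {a} {b} A B degA degB = concat⁺ (map⁺ (All.map (λ {s} → termBound {s}) degA))
    where
    termBound : ∀ {s} → length (proj₂ s) ≤ a → DegreeAtMost (a ℕ.+ b) (termTimes s B)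
    termBound {s} bs = map⁺ (All.map (λ bt →
      ℕP.≤-trans (ℕP.≤-reflexive (length-++ (proj₂ s))) (ℕP.+-mono-≤ bs bt)) degB)

  substMono-degree : ∀ s → (∀ w → DegreeAtMost 1 (s w)) → ∀ m → DegreeAtMost (length m) (substMono s m)
  substMono-degree s linear [] = z≤n ∷ []
  substMono-degree s linear (w ∷ m) = mulP-degree (s w) _ (linear w) (substMono-degree s linear m)

  -- p′: at (u, v) = (x - y, x + y) each substituted variable is twice the original one,
  -- so p′(x - y, x + y) = 2^d · p(x, y).
  eval-twiceSubst : ∀ (x y : Input d k) w → eval (atUV x y) (twiceSubst w) ≡ + 2 * atXY x y w
  eval-twiceSubst x y (var true i j) = doubled (bit (x i j)) (bit (y i j))
    where
    doubled : ∀ a b → 1ℤ * ((a - b) * 1ℤ) + (1ℤ * ((a + b) * 1ℤ) + 0ℤ) ≡ + 2 * a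
    doubled = solve-∀
  eval-twiceSubst x y (var false i j) = doubled (bit (x i j)) (bit (y i j))
    where
    doubled : ∀ a b → - 1ℤ * ((a - b) * 1ℤ) + (1ℤ * ((a + b) * 1ℤ) + 0ℤ) ≡ + 2 * b
    doubled = solve-∀

  twoPow-split : ∀ {l n} → l ≤ n → + (2 ℕ.^ (n ∸ l)) * + (2 ℕ.^ l) ≡ + (2 ℕ.^ n)
  twoPow-split {l} {n} l≤n = begin
    + (2 ℕ.^ (n ∸ l)) * + (2 ℕ.^ l) ≡⟨ sym (ℤP.pos-* (2 ℕ.^ (n ∸ l)) _) ⟩
    + (2 ℕ.^ (n ∸ l) ℕ.* 2 ℕ.^ l)   ≡⟨ cong +_ (sym (ℕP.^-distribˡ-+-* 2 (n ∸ l) l)) ⟩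
    + (2 ℕ.^ (n ∸ l ℕ.+ l))         ≡⟨ cong (λ e → + (2 ℕ.^ e)) (ℕP.m∸n+n≡m l≤n) ⟩
    + (2 ℕ.^ n)                     ∎
    where open ≡-Reasoning

  primeP-term : ∀ (x y : Input d k) c m → length m ≤ d →
    eval (atUV x y) (scaleP (c * + (2 ℕ.^ (d ∸ length m))) (substMono twiceSubst m))
      ≡ + (2 ℕ.^ d) * (c * evalMono (atXY x y) m)
  primeP-term x y c m m≤d = begin
    eval (atUV x y) (scaleP (c * A) (substMono twiceSubst m))
      ≡⟨ eval-scaleP (atUV x y) (c * A) (substMono twiceSubst m) ⟩
    c * A * eval (atUV x y) (substMono twiceSubst m)
      ≡⟨ cong (c * A *_) (eval-substMono (atUV x y) twiceSubst m) ⟩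
    c * A * evalMono (λ w → eval (atUV x y) (twiceSubst w)) m
      ≡⟨ cong (c * A *_) (evalMono-cong (eval-twiceSubst x y) m) ⟩
    c * A * evalMono (λ w → + 2 * atXY x y w) m
      ≡⟨ cong (c * A *_) (evalMono-scale (atXY x y) 2 m) ⟩
    c * A * (B * e)
      ≡⟨ regroup c A B e ⟩
    A * B * (c * e)
      ≡⟨ cong (_* (c * e)) (twoPow-split m≤d) ⟩
    + (2 ℕ.^ d) * (c * e) ∎
    where
    open ≡-Reasoning
    A = + (2 ℕ.^ (d ∸ length m))
    B = + (2 ℕ.^ length m)
    e = evalMono (atXY x y) m
    regroup : ∀ c a b e → c * a * (b * e) ≡ a * b * (c * e)
    regroup = solve-∀

  primeP-eval : ∀ (x y : Input d k) p → DegreeAtMost d p →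
    eval (atUV x y) (primeP d k p) ≡ + (2 ℕ.^ d) * eval (atXY x y) p
  primeP-eval x y [] [] = sym (ℤP.*-zeroʳ (+ (2 ℕ.^ d)))
  primeP-eval x y ((c , m) ∷ p) (m≤d ∷ deg) = begin
    eval (atUV x y) (term ++ primeP d k p)
      ≡⟨ eval-++ (atUV x y) term (primeP d k p) ⟩
    eval (atUV x y) term + eval (atUV x y) (primeP d k p)
      ≡⟨ cong₂ _+_ (primeP-term x y c m m≤d) (primeP-eval x y p deg) ⟩
    + (2 ℕ.^ d) * (c * evalMono (atXY x y) m) + + (2 ℕ.^ d) * eval (atXY x y) p
      ≡⟨ sym (ℤP.*-distribˡ-+ (+ (2 ℕ.^ d)) _ _) ⟩
    + (2 ℕ.^ d) * eval (atXY x y) ((c , m) ∷ p) ∎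
    where
    open ≡-Reasoning
    term = scaleP (c * + (2 ℕ.^ (d ∸ length m))) (substMono twiceSubst m)

  primeP-degree : ∀ p → DegreeAtMost d p → DegreeAtMost d (primeP d k p)
  primeP-degree p deg = concat⁺ (map⁺ (All.map (λ {t} → termBound {t}) deg))
    where
    linear : ∀ w → DegreeAtMost 1 (twiceSubst w)
    linear (var true i j) = ℕP.≤-refl ∷ ℕP.≤-refl ∷ []
    linear (var false i j) = ℕP.≤-refl ∷ ℕP.≤-refl ∷ []
    termBound : ∀ {t} → length (proj₂ t) ≤ d →
      DegreeAtMost d (scaleP (proj₁ t * + (2 ℕ.^ (d ∸ length (proj₂ t)))) (substMono twiceSubst (proj₂ t)))
    termBound {t} m≤d = map⁺ (All.map (λ le → ℕP.≤-trans le m≤d)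
                                      (substMono-degree twiceSubst linear (proj₂ t)))

  isU : Fin d → Var d k → Bool
  isU i w = side w ∧ ⌊ grp w ≟F i ⌋

  uCount : Fin d → List (Var d k) → ℕ
  uCount i [] = 0
  uCount i (w ∷ m) = (if isU i w then 1 else 0) ℕ.+ uCount i m

  uCount-present : ∀ i m → T (hasU i m) → 1 ≤ uCount i m
  uCount-present i (w ∷ m) h with isU i w
  ... | true = s≤s z≤n
  ... | false = uCount-present i m h

  uCount-absent : ∀ i m → hasU i m ≡ false → uCount i m ≡ 0
  uCount-absent i [] h = refl
  uCount-absent i (w ∷ m) h with isU i w
  ... | false = uCount-absent i m h

  -- A variable belongs to at most one group, so the group counts add up to at most |m|.
  sum-uCount : ∀ m → sum (λ i → uCount i m) ≤ length m
  sum-uCount [] = ℕP.≤-reflexive (sum-replicate-zero d)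
  sum-uCount (w ∷ m) = begin
    sum (λ i → (if isU i w then 1 else 0) ℕ.+ uCount i m)
      ≡⟨ ∑-distrib-+ (λ i → if isU i w then 1 else 0) (λ i → uCount i m) ⟩
    sum (λ i → if isU i w then 1 else 0) ℕ.+ sum (λ i → uCount i m)
      ≤⟨ ℕP.+-mono-≤ (atMostOneGroup w) (sum-uCount m) ⟩
    suc (length m) ∎
    where
    open ℕP.≤-Reasoning
    atMostOneGroup : ∀ w → sum (λ i → if isU i w then 1 else 0) ≤ 1
    atMostOneGroup (var true g j) = ℕP.≤-reflexive (sum-indicator g)
    atMostOneGroup (var false g j) = ℕP.≤-trans (ℕP.≤-reflexive (sum-replicate-zero d)) z≤n

  meetsEachGroupOnce : ∀ m → length m ≤ d → (∀ i → T (hasU i m)) → ∀ i → uCount i m ≡ 1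
  meetsEachGroupOnce m m≤d meets =
    sum-tight (λ i → uCount i m) (λ i → uCount-present i m (meets i))
              (ℕP.≤-trans (sum-uCount m) m≤d)

  coversAll : List (Var d k) → Bool
  coversAll m = all (λ i → hasU i m) (allFin d)

  coversAll-meets : ∀ m → coversAll m ≡ true → ∀ i → T (hasU i m)
  coversAll-meets m covers i =
    All.lookup (all⁺ _ (allFin d) (Equivalence.from T-≡ covers)) (∈-allFin i)

  negGroup : Fin d → Assignment → Assignment
  negGroup i ρ w = if isU i w then - ρ w else ρ w

  evalMono-negGroup : ∀ i ρ m → evalMono (negGroup i ρ) m ≡ (- 1ℤ) ^ uCount i m * evalMono ρ m
  evalMono-negGroup i ρ [] = refl
  evalMono-negGroup i ρ (w ∷ m) with isU i w
  ... | true rewrite evalMono-negGroup i ρ m = negate (ρ w) ((- 1ℤ) ^ uCount i m) (evalMono ρ m)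
    where
    negate : ∀ r s e → - r * (s * e) ≡ - 1ℤ * s * (r * e)
    negate = solve-∀
  ... | false rewrite evalMono-negGroup i ρ m = commute (ρ w) ((- 1ℤ) ^ uCount i m) (evalMono ρ m)
    where
    commute : ∀ r s e → r * (s * e) ≡ s * (r * e)
    commute = solve-∀

  -- Symmetrizing over the groups in L multiplies the term c·m by
  -- ∏_{i ∈ L} (1 - (-1)^(u^i-count of m)).
  symWeight : List (Fin d) → List (Var d k) → ℤ
  symWeight [] m = 1ℤ
  symWeight (i ∷ L) m = (1ℤ - (- 1ℤ) ^ uCount i m) * symWeight L m

  weigh : (List (Var d k) → ℤ) → Poly d k → Poly d k
  weigh ω P = map (λ t → (proj₁ t * ω (proj₂ t) , proj₂ t)) P

  eval-weigh-[] : ∀ (ρ : Assignment) P → eval ρ (weigh (symWeight []) P) ≡ eval ρ P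
  eval-weigh-[] ρ [] = refl
  eval-weigh-[] ρ ((c , m) ∷ P) =
    cong₂ _+_ (cong (_* evalMono ρ m) (ℤP.*-identityʳ c)) (eval-weigh-[] ρ P)

  eval-weigh-∷ : ∀ i L (ρ : Assignment) P →
    eval ρ (weigh (symWeight (i ∷ L)) P)
      ≡ eval ρ (weigh (symWeight L) P) - eval (negGroup i ρ) (weigh (symWeight L) P)
  eval-weigh-∷ i L ρ [] = refl
  eval-weigh-∷ i L ρ ((c , m) ∷ P)
    rewrite eval-weigh-∷ i L ρ P | evalMono-negGroup i ρ m =
    expand c ((- 1ℤ) ^ uCount i m) (symWeight L m) (evalMono ρ m)
           (eval ρ (weigh (symWeight L) P)) (eval (negGroup i ρ) (weigh (symWeight L) P))
    where
    expand : ∀ c s w e r r′ → c * ((1ℤ - s) * w) * e + (r - r′) ≡ (c * w * e + r) - (c * w * (s * e) + r′)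
    expand = solve-∀

  symWeight-missing : ∀ L m → all (λ i → hasU i m) L ≡ false → symWeight L m ≡ 0ℤ
  symWeight-missing (i ∷ L) m misses with hasU i m in meets
  ... | true = trans (cong ((1ℤ - (- 1ℤ) ^ uCount i m) *_) (symWeight-missing L m misses))
                     (ℤP.*-zeroʳ (1ℤ - (- 1ℤ) ^ uCount i m))
  ... | false rewrite uCount-absent i m meets = refl

  symWeight-once : ∀ m → (∀ i → uCount i m ≡ 1) → ∀ L → symWeight L m ≡ + (2 ℕ.^ length L)
  symWeight-once m once [] = refl
  symWeight-once m once (i ∷ L) rewrite once i | symWeight-once m once L =
    sym (ℤP.pos-* 2 (2 ℕ.^ length L))

  -- keep exactly the terms whose monomial meets every group; qP d k p is keepFull (primeP d k p)
  keepFull : Poly d k → Poly d k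
  keepFull P = filter (λ t → coversAll (proj₂ t) Bool.≟ true) P

  eval-weigh-all : ∀ (ρ : Assignment) P → DegreeAtMost d P →
    eval ρ (weigh (symWeight (allFin d)) P) ≡ + (2 ℕ.^ d) * eval ρ (keepFull P)
  eval-weigh-all ρ [] [] = sym (ℤP.*-zeroʳ (+ (2 ℕ.^ d)))
  eval-weigh-all ρ ((c , m) ∷ P) (m≤d ∷ deg) with coversAll m in covers
  ... | true rewrite symWeight-once m (meetsEachGroupOnce m m≤d (coversAll-meets m covers)) (allFin d)
                   | length-tabulate {n = d} id | eval-weigh-all ρ P deg =
    factor c (+ (2 ℕ.^ d)) (evalMono ρ m) (eval ρ (keepFull P))
    where
    factor : ∀ c a e z → c * a * e + a * z ≡ a * (c * e + z)
    factor = solve-∀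
  ... | false rewrite symWeight-missing (allFin d) m covers | eval-weigh-all ρ P deg =
    dropped c (evalMono ρ m) _
    where
    dropped : ∀ c e z → c * 0ℤ * e + z ≡ z
    dropped = solve-∀

  -- A monomial with a vanishing factor vanishes; hence keepFull P vanishes as soon as
  -- all variables of one group u^i are set to 0 (every kept monomial contains one).
  evalMono-vanish : ∀ (ρ : Assignment) m → Any (λ w → ρ w ≡ 0ℤ) m → evalMono ρ m ≡ 0ℤ
  evalMono-vanish ρ (w ∷ m) (here ρw≡0) = cong (_* evalMono ρ m) ρw≡0
  evalMono-vanish ρ (w ∷ m) (there zero∈m) =
    trans (cong (ρ w *_) (evalMono-vanish ρ m zero∈m)) (ℤP.*-zeroʳ (ρ w))

  keepFull-vanish : ∀ (ρ : Assignment) i → (∀ j → ρ (var true i j) ≡ 0ℤ) →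
    ∀ P → eval ρ (keepFull P) ≡ 0ℤ
  keepFull-vanish ρ i zeroOnGroup [] = refl
  keepFull-vanish ρ i zeroOnGroup ((c , m) ∷ P) with coversAll m in covers
  ... | true = cong₂ _+_ (trans (cong (c *_) monomial≡0) (ℤP.*-zeroʳ c))
                         (keepFull-vanish ρ i zeroOnGroup P)
    where
    vanishOnGroup : ∀ {w} → T (isU i w) → ρ w ≡ 0ℤ
    vanishOnGroup {var true g j} inGroup with g ≟F i
    ... | yes refl = zeroOnGroup j
    ... | no _ = ⊥-elim inGroup
    monomial≡0 : evalMono ρ m ≡ 0ℤ
    monomial≡0 = evalMono-vanish ρ m
      (Any.map vanishOnGroup (any⁻ (isU i) m (coversAll-meets m covers i)))
  ... | false = keepFull-vanish ρ i zeroOnGroup P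

maxK-∈ : ∀ {d k} (l : List (K d k)) β → maxK l ≡ just β → β ∈ l
maxK-∈ (α ∷ αs) β eq with maxK αs in eqRest
maxK-∈ (α ∷ αs) .α refl | nothing = here refl
... | just γ with α <K γ
maxK-∈ (α ∷ αs) .γ refl | just γ | true = there (maxK-∈ αs γ eqRest)
maxK-∈ (α ∷ αs) .α refl | just γ | false = here refl

maxK-nonempty : ∀ {d k} (l : List (K d k)) {α} → α ∈ l → Σ (K d k) (λ β → maxK l ≡ just β)
maxK-nonempty (α ∷ αs) _ with maxK αs
... | nothing = α , refl
... | just γ = _ , refl

allK-complete : ∀ d (k : Fin d → ℕ) (α : K d k) → Σ (K d k) (λ β → β ∈ allK d k × (∀ i → β i ≡ α i))
allK-complete zero k α = (λ ()) , here refl , (λ ())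
allK-complete (suc d) k α with allK-complete d (λ i → k (suc i)) (λ i → α (suc i))
... | β , β∈allK , β≗α =
  _ , ∈-concatMap⁺ _ (lose (∈-allFin (α zero)) (∈-map⁺ _ β∈allK)) , λ { zero → refl ; (suc i) → β≗α i }

isNonzero-neg : ∀ t → isNonzero (- t) ≡ isNonzero t
isNonzero-neg (+ zero) = refl
isNonzero-neg (+ suc n) = refl
isNonzero-neg -[1+ n ] = refl

isNonzero-sound : ∀ t → isNonzero t ≡ true → t ≢ 0ℤ
isNonzero-sound .(+ zero) () refl

isNonzero-complete : ∀ t → t ≢ 0ℤ → isNonzero t ≡ true
isNonzero-complete (+ zero) t≢0 = ⊥-elim (t≢0 refl)
isNonzero-complete (+ suc n) _ = refl
isNonzero-complete -[1+ n ] _ = refl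

bitDiff-same : ∀ a → bit a - bit a ≡ 0ℤ
bitDiff-same false = refl
bitDiff-same true = refl

bitDiff-distinct : ∀ a b → a ≢ b → bit a - bit b ≢ 0ℤ
bitDiff-distinct false false a≢b _ = a≢b refl
bitDiff-distinct true true a≢b _ = a≢b refl
bitDiff-distinct false true _ ()
bitDiff-distinct true false _ ()

bitDiff-swap : ∀ a b → bit b - bit a ≡ - (bit a - bit b)
bitDiff-swap false false = refl
bitDiff-swap false true = refl
bitDiff-swap true false = refl
bitDiff-swap true true = refl

module _ {d : ℕ} {k : Fin d → ℕ} where

  support : Input d k → Input d k → List (K d k)
  support x y = filter (λ α → isNonzero (diffProd d k x y α) Bool.≟ true) (allK d k)

  f-at-max : ∀ x y β → maxK (support x y) ≡ just β → f d k x y ≡ sgn (diffProd d k x y β)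
  f-at-max x y β eq with maxK (support x y)
  f-at-max x y β refl | just .β = refl

  support-nonzero : ∀ x y {β} → β ∈ support x y → diffProd d k x y β ≢ 0ℤ
  support-nonzero x y {β} β∈ =
    isNonzero-sound _ (proj₂ (∈-filter⁻ (λ α → isNonzero (diffProd d k x y α) Bool.≟ true)
                                        {xs = allK d k} β∈))

  -- Inputs at which f is decided by a nonzero product.
  Decisive : Input d k → Input d k → Set
  Decisive x y = Σ (K d k) (λ β → maxK (support x y) ≡ just β)

  groupsDiffer⇒decisive : ∀ x y → (∀ i → Σ (Fin (k i)) (λ j → x i j ≢ y i j)) → Decisive x y
  groupsDiffer⇒decisive x y differ with allK-complete d k (λ i → proj₁ (differ i))
  ... | β , β∈allK , β≗α = maxK-nonempty (support x y) β∈support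
    where
    nonzero : diffProd d k x y β ≢ 0ℤ
    nonzero = prodFin-nonzero d _ (λ i →
      subst (λ j → bit (x i j) - bit (y i j) ≢ 0ℤ) (sym (β≗α i))
            (bitDiff-distinct _ _ (proj₂ (differ i))))
    β∈support : β ∈ support x y
    β∈support = ∈-filter⁺ (λ α → isNonzero (diffProd d k x y α) Bool.≟ true) β∈allK
                          (isNonzero-complete _ nonzero)

  uVanish : ∀ (x y : Input d k) i → (∀ j → x i j ≡ y i j) → ∀ j → atUV x y (var true i j) ≡ 0ℤ
  uVanish x y i same j = trans (cong (λ b → bit b - bit (y i j)) (same j)) (bitDiff-same (y i j))

  groupEqual⇒f≡1 : ∀ x y i → (∀ j → x i j ≡ y i j) → f d k x y ≡ 1
  groupEqual⇒f≡1 x y i same with maxK (support x y) in eq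
  ... | nothing = refl
  ... | just β = ⊥-elim (support-nonzero x y (maxK-∈ (support x y) β eq)
                           (prodFin-zero d _ i (uVanish x y i same (β i))))

  swapGroup : Fin d → Input d k → Input d k → Input d k
  swapGroup i x y i′ j with i′ ≟F i
  ... | yes _ = y i′ j
  ... | no _ = x i′ j

  diffProd-swap : ∀ i x y α →
    diffProd d k (swapGroup i x y) (swapGroup i y x) α ≡ - diffProd d k x y α
  diffProd-swap i x y α = prodFin-negate d _ _ i otherFactor swappedFactor
    where
    otherFactor : ∀ i′ → i′ ≢ i →
      bit (swapGroup i x y i′ (α i′)) - bit (swapGroup i y x i′ (α i′)) ≡ bit (x i′ (α i′)) - bit (y i′ (α i′))
    otherFactor i′ i′≢i with i′ ≟F i
    ... | yes i′≡i = ⊥-elim (i′≢i i′≡i)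
    ... | no _ = refl
    swappedFactor :
      bit (swapGroup i x y i (α i)) - bit (swapGroup i y x i (α i)) ≡ - (bit (x i (α i)) - bit (y i (α i)))
    swappedFactor with i ≟F i
    ... | yes _ = bitDiff-swap (x i (α i)) (y i (α i))
    ... | no i≢i = ⊥-elim (i≢i refl)

  support-swap : ∀ i x y → support (swapGroup i x y) (swapGroup i y x) ≡ support x y
  support-swap i x y = filter-≐ (λ α → isNonzero (diffProd d k (swapGroup i x y) (swapGroup i y x) α) Bool.≟ true)
                                (λ α → isNonzero (diffProd d k x y α) Bool.≟ true)
                                ((λ {α} → trans (sym (sameNonzero α))) , (λ {α} → trans (sameNonzero α)))
                                (allK d k)
    where
    sameNonzero : ∀ α → isNonzero (diffProd d k (swapGroup i x y) (swapGroup i y x) α)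
                          ≡ isNonzero (diffProd d k x y α)
    sameNonzero α = trans (cong isNonzero (diffProd-swap i x y α)) (isNonzero-neg (diffProd d k x y α))

  swap-decisive : ∀ i x y → Decisive x y → Decisive (swapGroup i x y) (swapGroup i y x)
  swap-decisive i x y (β , atMax) = β , trans (cong maxK (support-swap i x y)) atMax

  swap-flips-f : ∀ i x y → Decisive x y → f d k (swapGroup i x y) (swapGroup i y x) ≢ f d k x y
  swap-flips-f i x y (β , atMax) flipped = sgn-neg D D≢0 (begin
    sgn (- D)                                              ≡⟨ cong sgn (sym (diffProd-swap i x y β)) ⟩
    sgn (diffProd d k (swapGroup i x y) (swapGroup i y x) β) ≡⟨ sym (f-at-max _ _ β atMax′) ⟩
    f d k (swapGroup i x y) (swapGroup i y x)              ≡⟨ flipped ⟩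
    f d k x y                                              ≡⟨ f-at-max x y β atMax ⟩
    sgn D                                                  ∎)
    where
    open ≡-Reasoning
    D = diffProd d k x y β
    D≢0 : D ≢ 0ℤ
    D≢0 = support-nonzero x y (maxK-∈ (support x y) β atMax)
    atMax′ : maxK (support (swapGroup i x y) (swapGroup i y x)) ≡ just β
    atMax′ = proj₂ (swap-decisive i x y (β , atMax))

  atUV-swap : ∀ i x y w → atUV (swapGroup i x y) (swapGroup i y x) w ≡ negGroup i (atUV x y) w
  atUV-swap i x y (var true i′ j) with i′ ≟F i
  ... | yes _ = bitDiff-swap (x i′ j) (y i′ j)
  ... | no _ = refl
  atUV-swap i x y (var false i′ j) with i′ ≟F i
  ... | yes _ = ℤP.+-comm (bit (y i′ j)) (bit (x i′ j))
  ... | no _ = refl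

  groupwiseCompare : ∀ (x y : Input d k) →
    (∀ i → Σ (Fin (k i)) (λ j → x i j ≢ y i j)) ⊎ Σ (Fin d) (λ i → ∀ j → x i j ≡ y i j)
  groupwiseCompare x y with all? (λ i → any? (λ j → ¬? (x i j Bool.≟ y i j)))
  ... | yes differ = inj₁ differ
  ... | no ¬differ with ¬∀⟶∃¬ d _ (λ i → any? (λ j → ¬? (x i j Bool.≟ y i j))) ¬differ
  ... | i , ¬differᵢ =
    inj₂ (i , λ j → decidable-stable (x i j Bool.≟ y i j) (λ x≢y → ¬differᵢ (j , x≢y)))

  SignRep : (Input d k → Input d k → ℤ) → Set
  SignRep g = ∀ x y → Decisive x y → f d k x y ≡ sgn (g x y)

  SignRep-sgn : ∀ g h → (∀ x y → sgn (g x y) ≡ sgn (h x y)) → SignRep g → SignRep h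
  SignRep-sgn g h sameSign rep x y dec = trans (rep x y dec) (sameSign x y)

  -- Key step: as f flips under swapping group i, g - g ∘ swap has the sign of g.
  symmetrize : ∀ i g → SignRep g →
    SignRep (λ x y → g x y - g (swapGroup i x y) (swapGroup i y x))
  symmetrize i g rep x y dec = trans (rep x y dec) (sym (sgn-sub (g x y) (g x′ y′) signsDiffer))
    where
    x′ = swapGroup i x y
    y′ = swapGroup i y x
    signsDiffer : sgn (g x y) ≢ sgn (g x′ y′)
    signsDiffer same = swap-flips-f i x y dec
      (trans (rep x′ y′ (swap-decisive i x y dec)) (trans (sym same) (sym (rep x y dec))))

  evalUV : Poly d k → Input d k → Input d k → ℤ
  evalUV P x y = eval (atUV x y) P

  symmetrize-poly : ∀ P → SignRep (evalUV P) → ∀ L → SignRep (evalUV (weigh (symWeight L) P))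
  symmetrize-poly P rep [] = SignRep-sgn (evalUV P) (evalUV (weigh (symWeight []) P)) (λ x y → cong sgn (sym (eval-weigh-[] (atUV x y) P))) rep
  symmetrize-poly P rep (i ∷ L) =
    SignRep-sgn (λ x y → evalUV Q x y - evalUV Q (swapGroup i x y) (swapGroup i y x))
                (evalUV (weigh (symWeight (i ∷ L)) P))
                (λ x y → cong sgn (sym (asWeights x y)))
                (symmetrize i (evalUV Q) (symmetrize-poly P rep L))
    where
    Q = weigh (symWeight L) P
    asWeights : ∀ x y → evalUV (weigh (symWeight (i ∷ L)) P) x y
                         ≡ evalUV Q x y - evalUV Q (swapGroup i x y) (swapGroup i y x)
    asWeights x y = trans (eval-weigh-∷ i L (atUV x y) P)
                          (cong (λ z → evalUV Q x y - z) (sym (eval-cong (atUV-swap i x y) Q)))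

  q-signRep : ∀ p → DegreeAtMost d p → (∀ x y → f d k x y ≡ sgn (eval (atXY x y) p)) →
    SignRep (evalUV (qP d k p))
  q-signRep p deg rep = SignRep-sgn scaledQ (evalUV (qP d k p)) dropFactor
    (SignRep-sgn (evalUV (weigh (symWeight (allFin d)) p′)) scaledQ toKept
      (symmetrize-poly p′ p′-rep (allFin d)))
    where
    p′ = primeP d k p
    scaledQ : Input d k → Input d k → ℤ
    scaledQ x y = + (2 ℕ.^ d) * evalUV (qP d k p) x y
    2^d>0 : 0 ℕ.< 2 ℕ.^ d
    2^d>0 = ℕP.m^n>0 2 d
    p′-rep : SignRep (evalUV p′)
    p′-rep x y _ = trans (rep x y)
      (sym (trans (cong sgn (primeP-eval x y p deg)) (sgn-*-pos 2^d>0 (eval (atXY x y) p))))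
    toKept : ∀ x y → sgn (evalUV (weigh (symWeight (allFin d)) p′) x y)
                       ≡ sgn (scaledQ x y)
    toKept x y = cong sgn (eval-weigh-all (atUV x y) p′ (primeP-degree p deg))
    dropFactor : ∀ x y → sgn (scaledQ x y) ≡ sgn (evalUV (qP d k p) x y)
    dropFactor x y = sgn-*-pos 2^d>0 (evalUV (qP d k p) x y)

-- If every group of x differs from that of y, the input is decisive and the main lemma
-- applies; otherwise f = 1 = sgn 0 and q vanishes.
lemma3p7 : (d : ℕ) → 1 ≤ d → (k : Fin d → ℕ) → (∀ i → 1 ≤ k i) →
    (p : Poly d k) → DegreeAtMost d p →
    (∀ (x y : Input d k) → f d k x y ≡ sgn (eval (atXY x y) p)) →
    ∀ (x y : Input d k) → f d k x y ≡ sgn (eval (atUV x y) (qP d k p))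
lemma3p7 d _ k _ p deg rep x y with groupwiseCompare x y
... | inj₁ differ = q-signRep p deg rep x y (groupsDiffer⇒decisive x y differ)
... | inj₂ (i , same) = begin
  f d k x y                         ≡⟨ groupEqual⇒f≡1 x y i same ⟩
  sgn 0ℤ                            ≡⟨ cong sgn (sym q≡0) ⟩
  sgn (eval (atUV x y) (qP d k p)) ∎
  where
  open ≡-Reasoning
  q≡0 : eval (atUV x y) (qP d k p) ≡ 0ℤ
  q≡0 = keepFull-vanish (atUV x y) i (uVanish x y i same) (primeP d k p)
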